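{- As $n\to\infty$, $|S_{5,0,4}(n)|=O(n^{0.81092\ldots})$, where the exponent is $\ln(5+2\sqrt5)/\ln 16$.
   Context: For an integer $k\ge 0$ let $\sigma_4(k)$ be the sum of its base-4 digits. For $x\in\mathbb{N}$ define $S_{5,0,4}(x)=\sum_{0\le k<x,\ 5\mid k}(-1)^{\sigma_4(k)}$. -}

module Defs where

open import Data.Nat using (ℕ; zero; suc; _+_; _*_; _∸_; _^_; _≤_; _<_)
open import Data.Nat.DivMod using (_/_; _%_)
open import Data.Nat.Divisibility using (_∣?_)
open import Data.Integer as ℤ using (ℤ)
open import Data.Product using (_×_; _,_; proj₁; proj₂)
open import Relation.Nullary.Decidable using (does)
open import Data.Bool using (if_then_else_)

-- Sum of base-4 digits.  The fuel argument is only for termination: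
-- with fuel ≥ n the result is the true base-4 digit sum of n
-- (each step divides by 4, and digitSum4 0 = 0 anyway).
digitSum4′ : ℕ → ℕ → ℕ
digitSum4′ zero    n = 0
digitSum4′ (suc f) n = n % 4 + digitSum4′ f (n / 4)

σ₄ : ℕ → ℕ
σ₄ n = digitSum4′ n n

signPow : ℕ → ℤ
signPow zero    = ℤ.+ 1
signPow (suc m) = ℤ.- signPow m

S₅₀₄ : ℕ → ℤ
S₅₀₄ zero    = ℤ.+ 0
S₅₀₄ (suc x) = S₅₀₄ x ℤ.+ (if does (5 ∣? x) then signPow (σ₄ x) else ℤ.+ 0)

-- λ = 5 + 2√5.  λ^q = A q + B q · √5 with A q, B q ∈ ℕ.
λPow : ℕ → ℕ × ℕ
λPow zero    = 1 , 0
λPow (suc q) with λPow q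
... | a , b = 5 * a + 10 * b , 2 * a + 5 * b

-- ExpAbove p q  ⇔  16^p > λ^q = A + B√5  ⇔  p/q > α := ln λ / ln 16  (for q > 0).
-- 16^p > A + B√5  ⇔  16^p > A  and  (16^p - A)^2 > 5 B^2.
ExpAbove : ℕ → ℕ → Set
ExpAbove p q = (proj₁ (λPow q) < 16 ^ p)
             × (5 * (proj₂ (λPow q) * proj₂ (λPow q))
                  < (16 ^ p ∸ proj₁ (λPow q)) * (16 ^ p ∸ proj₁ (λPow q)))

{-# OPTIONS --safe #-}
-- Collect the five sums S_{5,r,4}(n), r mod 5, into one element Svec n of the group ring ℤ[C₅].
-- Since (-1)^σ₄ is multiplicative over base-16 digits and 16 ≡ 1 (mod 5), appending a digit
-- gives Svec (b + 16 a) = W Svec a + ε(a) xᵃ Svec b with W = Svec 16 and Svec b bounded.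
-- Unrolling over the L base-16 digits of n gives Svec n = E + W X + M Y (M = W² − 5W), where the
-- sup-norms of X and Y grow by the matrix [[5, 20], [1, 5]] of spectral radius λ = 5 + 2√5,
-- because W² = 5W + M and WM = 20W + 5M.  So |S(n)| = O(λ^L), and in ℕ[√5] the hypothesis
-- λ^q < 16^p turns λ^{qL} into at most 16^{pL} ≤ n^p.
module Submission where

open import Defs
open import Data.Nat using (ℕ; _^_; _*_; _≤_; _<_)
open import Data.Integer using (∣_∣)
open import Data.Product using (∃-syntax)

open import Level using (0ℓ)
open import Algebra.Bundles.Raw using (RawRing)
open import Data.Bool using (if_then_else_)
open import Data.Integer as ℤ using (ℤ)
import Data.Integer.Properties as ℤ
open import Data.Integer.Tactic.RingSolver using (ring)
open import Data.List using (List; []; _∷_; _++_; concatMap; length)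
open import Data.Nat using (zero; suc; _+_; _∸_; _≡ᵇ_; NonZero; z≤n; s≤s; _≤?_; _<?_)
open import Data.Nat.DivMod
open import Data.Nat.Divisibility using (divides-refl)
open import Data.Nat.GeneralisedArithmetic using (fold; fold-+)
open import Data.Nat.Properties
open import Data.Nat.Tactic.RingSolver using (solve-∀)
open import Data.Product using (_×_; _,_; proj₁; proj₂)
open import Data.Vec using (Vec; fromList)
open import Relation.Binary.PropositionalEquality
open import Relation.Nullary.Decidable using (yes; no)
open import Relation.Nullary.Negation using (contradiction)
open import Function using (_∘_)
open import Tactic.RingSolver.NonReflective ring
  using (module Ops; Expr; Κ; Ι) renaming (_⊕_ to _:+_; _⊗_ to _:*_; ⊝_ to :-_)
open Ops using (prove; ⟦_⟧; ⟦_⇓⟧)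

digitSum4′-0 : ∀ f → digitSum4′ f 0 ≡ 0
digitSum4′-0 zero    = refl
digitSum4′-0 (suc f) = digitSum4′-0 f

digitSum4′-fuel : ∀ f g n → n ≤ f → n ≤ g → digitSum4′ f n ≡ digitSum4′ g n
digitSum4′-fuel zero    g       zero _ _ = sym (digitSum4′-0 g)
digitSum4′-fuel (suc f) zero    zero _ _ = digitSum4′-0 (suc f)
digitSum4′-fuel (suc f) (suc g) n n≤f n≤g =
  cong ((n % 4) +_) (digitSum4′-fuel f g (n / 4) (quarter≤ n≤f) (quarter≤ n≤g))
  where
  quarter≤ : ∀ {n f} → n ≤ suc f → n / 4 ≤ f
  quarter≤ {zero}  _         = z≤n
  quarter≤ {suc n} (s≤s n≤f) = ≤-trans (≤-pred (m/n<m (suc n) 4 (s≤s (s≤s z≤n)))) n≤f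

σ₄-step : ∀ n → σ₄ n ≡ n % 4 + σ₄ (n / 4)
σ₄-step zero    = refl
σ₄-step (suc n) = cong ((suc n % 4) +_)
  (digitSum4′-fuel n (suc n / 4) (suc n / 4) (≤-pred (m/n<m (suc n) 4 (s≤s (s≤s z≤n)))) ≤-refl)

σ₄-+-* : ∀ k a b → b < 4 ^ k → σ₄ (b + a * 4 ^ k) ≡ σ₄ b + σ₄ a
σ₄-+-* zero    a zero    _ = cong σ₄ (*-identityʳ a)
σ₄-+-* zero    a (suc b) (s≤s ())
σ₄-+-* (suc k) a b b<4^k+1 = begin
  σ₄ (b + a * 4 ^ suc k)                  ≡⟨ cong (λ m → σ₄ (b + m)) (a*4^k*4 a (4 ^ k)) ⟩
  σ₄ (b + a * 4 ^ k * 4)                  ≡⟨ σ₄-step (b + a * 4 ^ k * 4) ⟩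
  (b + a * 4 ^ k * 4) % 4 + σ₄ ((b + a * 4 ^ k * 4) / 4)
    ≡⟨ cong₂ (λ r q → r + σ₄ q) ([m+kn]%n≡m%n b (a * 4 ^ k) 4) quotient ⟩
  b % 4 + σ₄ (b / 4 + a * 4 ^ k)          ≡⟨ cong ((b % 4) +_) (σ₄-+-* k a (b / 4) b/4<4^k) ⟩
  b % 4 + (σ₄ (b / 4) + σ₄ a)             ≡⟨ +-assoc (b % 4) _ _ ⟨
  b % 4 + σ₄ (b / 4) + σ₄ a               ≡⟨ cong (_+ σ₄ a) (σ₄-step b) ⟨
  σ₄ b + σ₄ a                             ∎
  where
  open ≡-Reasoning
  a*4^k*4 : ∀ a p → a * (4 * p) ≡ a * p * 4
  a*4^k*4 = solve-∀
  quotient : (b + a * 4 ^ k * 4) / 4 ≡ b / 4 + a * 4 ^ k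
  quotient = trans (+-distrib-/-∣ʳ b (divides-refl (a * 4 ^ k))) (cong (b / 4 +_) (m*n/n≡m (a * 4 ^ k) 4))
  b/4<4^k : b / 4 < 4 ^ k
  b/4<4^k = m<n*o⇒m/o<n (subst (b <_) (*-comm 4 (4 ^ k)) b<4^k+1)

signPow-+ : ∀ m n → signPow (m + n) ≡ signPow m ℤ.* signPow n
signPow-+ zero    n = sym (ℤ.*-identityˡ (signPow n))
signPow-+ (suc m) n = trans (cong ℤ.-_ (signPow-+ m n)) (ℤ.neg-distribˡ-* (signPow m) (signPow n))

∣signPow∣≡1 : ∀ m → ∣ signPow m ∣ ≡ 1
∣signPow∣≡1 zero    = refl
∣signPow∣≡1 (suc m) = trans (ℤ.∣-i∣≡∣i∣ (signPow m)) (∣signPow∣≡1 m)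

ε : ℕ → ℤ
ε k = signPow (σ₄ k)

ε-+-*16 : ∀ a b → b < 16 → ε (b + a * 16) ≡ ε a ℤ.* ε b
ε-+-*16 a b b<16 = trans (cong signPow (trans (σ₄-+-* 2 a b b<16) (+-comm (σ₄ b) (σ₄ a))))
                         (signPow-+ (σ₄ a) (σ₄ b))

record C₅ (A : Set) : Set where
  constructor v5
  field c0 c1 c2 c3 c4 : A
open C₅

map₅ : ∀ {A B : Set} → (A → B) → C₅ A → C₅ B
map₅ f (v5 a0 a1 a2 a3 a4) = v5 (f a0) (f a1) (f a2) (f a3) (f a4)

toList₅ : ∀ {A : Set} → C₅ A → List A
toList₅ (v5 a0 a1 a2 a3 a4) = a0 ∷ a1 ∷ a2 ∷ a3 ∷ a4 ∷ []

C₅-≡ : ∀ {A : Set} {u v : C₅ A} →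
       c0 u ≡ c0 v → c1 u ≡ c1 v → c2 u ≡ c2 v → c3 u ≡ c3 v → c4 u ≡ c4 v → u ≡ v
C₅-≡ refl refl refl refl refl = refl

-- Multiplication by the generator x of C₅; rotⁿ n is multiplication by xⁿ.
rot : ∀ {A : Set} → C₅ A → C₅ A
rot (v5 a0 a1 a2 a3 a4) = v5 a4 a0 a1 a2 a3

rotⁿ : ∀ {A : Set} → ℕ → C₅ A → C₅ A
rotⁿ n v = fold v rot n

module GroupRing (R : RawRing 0ℓ 0ℓ) where
  open RawRing R using (Carrier; 0#; 1#) renaming (_+_ to _+ᴿ_; _*_ to _*ᴿ_)

  infixl 6 _⊕_
  infixl 7 _⊙_ _∗_

  0̂ 1̂ : C₅ Carrier
  0̂ = v5 0# 0# 0# 0# 0#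
  1̂ = v5 1# 0# 0# 0# 0#

  _⊕_ : C₅ Carrier → C₅ Carrier → C₅ Carrier
  v5 a0 a1 a2 a3 a4 ⊕ v5 b0 b1 b2 b3 b4 = v5 (a0 +ᴿ b0) (a1 +ᴿ b1) (a2 +ᴿ b2) (a3 +ᴿ b3) (a4 +ᴿ b4)

  _⊙_ : Carrier → C₅ Carrier → C₅ Carrier
  k ⊙ v = map₅ (k *ᴿ_) v

  dot : C₅ Carrier → C₅ Carrier → Carrier
  dot (v5 a0 a1 a2 a3 a4) (v5 b0 b1 b2 b3 b4) = a0 *ᴿ b0 +ᴿ a1 *ᴿ b1 +ᴿ a2 *ᴿ b2 +ᴿ a3 *ᴿ b3 +ᴿ a4 *ᴿ b4

  -- (w ∗ v)ᵣ = Σₛ wₛ vᵣ₋ₛ, indices mod 5.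
  _∗_ : C₅ Carrier → C₅ Carrier → C₅ Carrier
  w ∗ v5 b0 b1 b2 b3 b4 = v5 (dot w (v5 b0 b4 b3 b2 b1)) (dot w (v5 b1 b0 b4 b3 b2))
                            (dot w (v5 b2 b1 b0 b4 b3)) (dot w (v5 b3 b2 b1 b0 b4))
                            (dot w (v5 b4 b3 b2 b1 b0))

Expr-rawRing : ℕ → RawRing 0ℓ 0ℓ
Expr-rawRing n = record
  { Carrier = Expr ℤ n ; _≈_ = _≡_ ; _+_ = _:+_ ; _*_ = _:*_ ; -_ = :-_
  ; 0# = Κ (ℤ.+ 0) ; 1# = Κ (ℤ.+ 1) }

open GroupRing ℤ.+-*-rawRing
open module Formal {n} = GroupRing (Expr-rawRing n) using ()
  renaming (0̂ to 0̂′; _⊕_ to _⊕′_; _⊙_ to _⊙′_; _∗_ to _∗′_)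

-- Identities in ℤ[C₅] are proved componentwise by the ring solver: the generic operations
-- above, run over the solver's expression syntax, produce both sides of each component.
prove₅ : ∀ {n} (ρ : Vec ℤ n) (L R : C₅ (Expr ℤ n)) →
         map₅ (λ e → ⟦ e ⇓⟧ ρ) L ≡ map₅ (λ e → ⟦ e ⇓⟧ ρ) R →
         map₅ (λ e → ⟦ e ⟧ ρ) L ≡ map₅ (λ e → ⟦ e ⟧ ρ) R
prove₅ ρ L R eq = C₅-≡ (prove ρ (c0 L) (c0 R) (cong c0 eq)) (prove ρ (c1 L) (c1 R) (cong c1 eq))
  (prove ρ (c2 L) (c2 R) (cong c2 eq)) (prove ρ (c3 L) (c3 R) (cong c3 eq)) (prove ρ (c4 L) (c4 R) (cong c4 eq))

values : (vs : List (C₅ ℤ)) (ks : List ℤ) → Vec ℤ (length (concatMap toList₅ vs ++ ks))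
values vs ks = fromList (concatMap toList₅ vs ++ ks)

var : ∀ {n} .{{_ : NonZero n}} → ℕ → Expr ℤ n
var {n} k = Ι (k mod n)

var₅ : ∀ {n} .{{_ : NonZero n}} → ℕ → C₅ (Expr ℤ n)
var₅ k = map₅ (λ i → var (k + i)) (v5 0 1 2 3 4)

const₅ : ∀ {n} → C₅ ℤ → C₅ (Expr ℤ n)
const₅ = map₅ Κ

∗-linear : ∀ w u k v → w ∗ (u ⊕ k ⊙ v) ≡ w ∗ u ⊕ k ⊙ (w ∗ v)
∗-linear w u k v = prove₅ (values (w ∷ u ∷ v ∷ []) (k ∷ []))
  (var₅ 0 ∗′ (var₅ 5 ⊕′ var 15 ⊙′ var₅ 10))
  (var₅ 0 ∗′ var₅ 5 ⊕′ var 15 ⊙′ (var₅ 0 ∗′ var₅ 10)) refl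

⊕-⊙-assoc : ∀ g k u m v → g ⊕ k ⊙ u ⊕ (k ℤ.* m) ⊙ v ≡ g ⊕ k ⊙ (u ⊕ m ⊙ v)
⊕-⊙-assoc g k u m v = prove₅ (values (g ∷ u ∷ v ∷ []) (k ∷ m ∷ []))
  (var₅ 0 ⊕′ var 15 ⊙′ var₅ 5 ⊕′ (var 15 :* var 16) ⊙′ var₅ 10)
  (var₅ 0 ⊕′ var 15 ⊙′ (var₅ 5 ⊕′ var 16 ⊙′ var₅ 10)) refl

⊕-⊙-0̂ : ∀ g k → g ⊕ k ⊙ 0̂ ≡ g
⊕-⊙-0̂ g k = prove₅ (values (g ∷ []) (k ∷ [])) (var₅ 0 ⊕′ var 5 ⊙′ 0̂′) (var₅ 0) refl

rotⁿ-0̂ : ∀ a → rotⁿ a 0̂ ≡ 0̂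
rotⁿ-0̂ zero    = refl
rotⁿ-0̂ (suc a) = cong rot (rotⁿ-0̂ a)

rotⁿ-*5 : ∀ {A : Set} q (v : C₅ A) → rotⁿ (q * 5) v ≡ v
rotⁿ-*5 zero    v = refl
rotⁿ-*5 (suc q) v = trans (fold-+ v rot 5 {q * 5}) (rotⁿ-*5 q v)

rotⁿ-%5 : ∀ {A : Set} n (v : C₅ A) → rotⁿ n v ≡ rotⁿ (n % 5) v
rotⁿ-%5 n v = trans (cong (λ m → rotⁿ m v) (m≡m%n+[m/n]*n n 5))
                    (trans (fold-+ v rot (n % 5) {n / 5 * 5}) (cong (rotⁿ (n % 5)) (rotⁿ-*5 (n / 5) v)))

rotⁿ-*16 : ∀ {A : Set} a (v : C₅ A) → rotⁿ (a * 16) v ≡ rotⁿ a v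
rotⁿ-*16 zero    v = refl
rotⁿ-*16 (suc a) v = trans (fold-+ v rot 16 {a * 16}) (cong rot (rotⁿ-*16 a v))

rotⁿ-⊕-⊙ : ∀ a u k v → rotⁿ a (u ⊕ k ⊙ v) ≡ rotⁿ a u ⊕ k ⊙ rotⁿ a v
rotⁿ-⊕-⊙ zero    u k v = refl
rotⁿ-⊕-⊙ (suc a) u k v = cong rot (rotⁿ-⊕-⊙ a u k v)

∗-rotⁿ : ∀ a w v → w ∗ rotⁿ a v ≡ rotⁿ a (w ∗ v)
∗-rotⁿ zero    w v = refl
∗-rotⁿ (suc a) w v = cong rot (∗-rotⁿ a w v)

xⁿ : ℕ → C₅ ℤ
xⁿ n = rotⁿ n 1̂

xⁿ-+-*16 : ∀ a b → xⁿ (b + a * 16) ≡ rotⁿ a (xⁿ b)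
xⁿ-+-*16 a b = trans (cong (λ m → rotⁿ m 1̂) (+-comm b (a * 16)))
                     (trans (fold-+ 1̂ rot (a * 16) {b}) (rotⁿ-*16 a (xⁿ b)))

-- The r-th component of Svec n is S_{5,r,4}(n).
Svec : ℕ → C₅ ℤ
Svec zero    = 0̂
Svec (suc n) = Svec n ⊕ ε n ⊙ xⁿ n

S₅₀₄≡c0-Svec : ∀ n → S₅₀₄ n ≡ c0 (Svec n)
S₅₀₄≡c0-Svec zero    = refl
S₅₀₄≡c0-Svec (suc n) = cong₂ ℤ._+_ (S₅₀₄≡c0-Svec n)
  (trans (indicator (n % 5) (m%n<n n 5)) (cong (λ v → ε n ℤ.* c0 v) (sym (rotⁿ-%5 n 1̂))))
  where
  -- does (5 ∣? n) computes to n % 5 ≡ᵇ 0.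
  indicator : ∀ k → k < 5 → (if k ≡ᵇ 0 then ε n else ℤ.+ 0) ≡ ε n ℤ.* c0 (xⁿ k)
  indicator 0 _ = sym (ℤ.*-identityʳ (ε n))
  indicator 1 _ = sym (ℤ.*-zeroʳ (ε n))
  indicator 2 _ = sym (ℤ.*-zeroʳ (ε n))
  indicator 3 _ = sym (ℤ.*-zeroʳ (ε n))
  indicator 4 _ = sym (ℤ.*-zeroʳ (ε n))
  indicator (suc (suc (suc (suc (suc _))))) (s≤s (s≤s (s≤s (s≤s (s≤s ())))))

-- W = (4, −3, 1, 1, −3) and M = (16, −14, 6, 6, −14), so ‖ W ‖₁ = 12 and ‖ M ‖₁ = 56.
W M : C₅ ℤ
W = Svec 16
M = W ∗ W ⊕ ℤ.- ℤ.+ 5 ⊙ W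

Svec-block : ∀ a b → b ≤ 16 → Svec (b + a * 16) ≡ Svec (a * 16) ⊕ ε a ⊙ rotⁿ a (Svec b)
Svec-block a zero    _ =
  sym (trans (cong (λ v → Svec (a * 16) ⊕ ε a ⊙ v) (rotⁿ-0̂ a)) (⊕-⊙-0̂ (Svec (a * 16)) (ε a)))
Svec-block a (suc b) b<16 = begin
  Svec (b + a * 16) ⊕ ε (b + a * 16) ⊙ xⁿ (b + a * 16)
    ≡⟨ cong₂ _⊕_ (Svec-block a b (<⇒≤ b<16)) (cong₂ _⊙_ (ε-+-*16 a b b<16) (xⁿ-+-*16 a b)) ⟩
  Svec (a * 16) ⊕ ε a ⊙ rotⁿ a (Svec b) ⊕ (ε a ℤ.* ε b) ⊙ rotⁿ a (xⁿ b)
    ≡⟨ ⊕-⊙-assoc (Svec (a * 16)) (ε a) _ (ε b) _ ⟩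
  Svec (a * 16) ⊕ ε a ⊙ (rotⁿ a (Svec b) ⊕ ε b ⊙ rotⁿ a (xⁿ b))
    ≡⟨ cong (λ v → Svec (a * 16) ⊕ ε a ⊙ v) (rotⁿ-⊕-⊙ a (Svec b) (ε b) (xⁿ b)) ⟨
  Svec (a * 16) ⊕ ε a ⊙ rotⁿ a (Svec (suc b)) ∎
  where open ≡-Reasoning

Svec-*16 : ∀ a → Svec (a * 16) ≡ W ∗ Svec a
Svec-*16 zero    = refl
Svec-*16 (suc a) = begin
  Svec (16 + a * 16)                    ≡⟨ Svec-block a 16 ≤-refl ⟩
  Svec (a * 16) ⊕ ε a ⊙ rotⁿ a W        ≡⟨ cong₂ (λ s v → s ⊕ ε a ⊙ v) (Svec-*16 a) (sym (∗-rotⁿ a W 1̂)) ⟩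
  W ∗ Svec a ⊕ ε a ⊙ (W ∗ xⁿ a)         ≡⟨ ∗-linear W (Svec a) (ε a) (xⁿ a) ⟨
  W ∗ Svec (suc a)                      ∎
  where open ≡-Reasoning

Svec-digits : ∀ a b → b < 16 → Svec (b + a * 16) ≡ W ∗ Svec a ⊕ ε a ⊙ rotⁿ a (Svec b)
Svec-digits a b b<16 = trans (Svec-block a b (<⇒≤ b<16)) (cong (_⊕ ε a ⊙ rotⁿ a (Svec b)) (Svec-*16 a))

-- Both sides agree because W ∗ W = 5 W + M and W ∗ M = 20 W + 5 M.
W∗-split : ∀ E X Y E′ → W ∗ (E ⊕ W ∗ X ⊕ M ∗ Y) ⊕ E′
                        ≡ E′ ⊕ W ∗ (E ⊕ ℤ.+ 5 ⊙ X ⊕ ℤ.+ 20 ⊙ Y) ⊕ M ∗ (X ⊕ ℤ.+ 5 ⊙ Y)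
W∗-split E X Y E′ = prove₅ (values (E ∷ X ∷ Y ∷ E′ ∷ []) [])
  (const₅ W ∗′ (var₅ 0 ⊕′ const₅ W ∗′ var₅ 5 ⊕′ const₅ M ∗′ var₅ 10) ⊕′ var₅ 15)
  (var₅ 15 ⊕′ const₅ W ∗′ (var₅ 0 ⊕′ Κ (ℤ.+ 5) ⊙′ var₅ 5 ⊕′ Κ (ℤ.+ 20) ⊙′ var₅ 10)
           ⊕′ const₅ M ∗′ (var₅ 5 ⊕′ Κ (ℤ.+ 5) ⊙′ var₅ 10)) refl

All₅ : ∀ {A : Set} → (A → Set) → C₅ A → Set
All₅ P (v5 a0 a1 a2 a3 a4) = P a0 × P a1 × P a2 × P a3 × P a4

Bounded : ℕ → C₅ ℤ → Set
Bounded c = All₅ (λ z → ∣ z ∣ ≤ c)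

‖_‖₁ : C₅ ℤ → ℕ
‖ v5 a0 a1 a2 a3 a4 ‖₁ = ∣ a0 ∣ + ∣ a1 ∣ + ∣ a2 ∣ + ∣ a3 ∣ + ∣ a4 ∣

∣+∣-≤ : ∀ i j {m n} → ∣ i ∣ ≤ m → ∣ j ∣ ≤ n → ∣ i ℤ.+ j ∣ ≤ m + n
∣+∣-≤ i j p q = ≤-trans (ℤ.∣i+j∣≤∣i∣+∣j∣ i j) (+-mono-≤ p q)

∣*∣-≤ : ∀ k x {c} → ∣ x ∣ ≤ c → ∣ k ℤ.* x ∣ ≤ ∣ k ∣ * c
∣*∣-≤ k x p = ≤-trans (≤-reflexive (ℤ.abs-* k x)) (*-monoʳ-≤ ∣ k ∣ p)

Bounded-mono : ∀ {c d} v → c ≤ d → Bounded c v → Bounded d v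
Bounded-mono _ c≤d (b0 , b1 , b2 , b3 , b4) =
  ≤-trans b0 c≤d , ≤-trans b1 c≤d , ≤-trans b2 c≤d , ≤-trans b3 c≤d , ≤-trans b4 c≤d

Bounded-0̂ : ∀ c → Bounded c 0̂
Bounded-0̂ c = z≤n , z≤n , z≤n , z≤n , z≤n

Bounded-⊕ : ∀ {c d} u v → Bounded c u → Bounded d v → Bounded (c + d) (u ⊕ v)
Bounded-⊕ (v5 u0 u1 u2 u3 u4) (v5 v0 v1 v2 v3 v4) (p0 , p1 , p2 , p3 , p4) (q0 , q1 , q2 , q3 , q4) =
  ∣+∣-≤ u0 v0 p0 q0 , ∣+∣-≤ u1 v1 p1 q1 , ∣+∣-≤ u2 v2 p2 q2 , ∣+∣-≤ u3 v3 p3 q3 , ∣+∣-≤ u4 v4 p4 q4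

Bounded-⊙ : ∀ {c} k v → Bounded c v → Bounded (∣ k ∣ * c) (k ⊙ v)
Bounded-⊙ k (v5 x0 x1 x2 x3 x4) (b0 , b1 , b2 , b3 , b4) =
  ∣*∣-≤ k x0 b0 , ∣*∣-≤ k x1 b1 , ∣*∣-≤ k x2 b2 , ∣*∣-≤ k x3 b3 , ∣*∣-≤ k x4 b4

Bounded-ε⊙ : ∀ {c} n v → Bounded c v → Bounded c (ε n ⊙ v)
Bounded-ε⊙ {c} n v bd = subst (λ d → Bounded d (ε n ⊙ v))
  (trans (cong (_* c) (∣signPow∣≡1 (σ₄ n))) (*-identityˡ c)) (Bounded-⊙ (ε n) v bd)

Bounded-rotⁿ : ∀ {c} a v → Bounded c v → Bounded c (rotⁿ a v)
Bounded-rotⁿ zero    v bd = bd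
Bounded-rotⁿ (suc a) v bd with rotⁿ a v | Bounded-rotⁿ a v bd
... | v5 _ _ _ _ _ | b0 , b1 , b2 , b3 , b4 = b4 , b0 , b1 , b2 , b3

∣dot∣-≤ : ∀ {c} w v → Bounded c v → ∣ dot w v ∣ ≤ ‖ w ‖₁ * c
∣dot∣-≤ {c} (v5 a0 a1 a2 a3 a4) (v5 x0 x1 x2 x3 x4) (b0 , b1 , b2 , b3 , b4) =
  ≤-trans (∣+∣-≤ (t0 ℤ.+ t1 ℤ.+ t2 ℤ.+ t3) t4
            (∣+∣-≤ (t0 ℤ.+ t1 ℤ.+ t2) t3
              (∣+∣-≤ (t0 ℤ.+ t1) t2 (∣+∣-≤ t0 t1 (∣*∣-≤ a0 x0 b0) (∣*∣-≤ a1 x1 b1)) (∣*∣-≤ a2 x2 b2))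
              (∣*∣-≤ a3 x3 b3))
            (∣*∣-≤ a4 x4 b4))
          (≤-reflexive (distrib (∣ a0 ∣) (∣ a1 ∣) (∣ a2 ∣) (∣ a3 ∣) (∣ a4 ∣) c))
  where
  t0 = a0 ℤ.* x0
  t1 = a1 ℤ.* x1
  t2 = a2 ℤ.* x2
  t3 = a3 ℤ.* x3
  t4 = a4 ℤ.* x4
  distrib : ∀ u0 u1 u2 u3 u4 c → u0 * c + u1 * c + u2 * c + u3 * c + u4 * c ≡ (u0 + u1 + u2 + u3 + u4) * c
  distrib = solve-∀

Bounded-∗ : ∀ {c} w v → Bounded c v → Bounded (‖ w ‖₁ * c) (w ∗ v)
Bounded-∗ w (v5 _ _ _ _ _) (b0 , b1 , b2 , b3 , b4) =
  ∣dot∣-≤ w _ (b0 , b4 , b3 , b2 , b1) , ∣dot∣-≤ w _ (b1 , b0 , b4 , b3 , b2) ,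
  ∣dot∣-≤ w _ (b2 , b1 , b0 , b4 , b3) , ∣dot∣-≤ w _ (b3 , b2 , b1 , b0 , b4) ,
  ∣dot∣-≤ w _ (b4 , b3 , b2 , b1 , b0)

Bounded-Svec : ∀ n → Bounded n (Svec n)
Bounded-Svec zero    = Bounded-0̂ 0
Bounded-Svec (suc n) = subst (λ c → Bounded c (Svec (suc n))) (+-comm n 1)
  (Bounded-⊕ (Svec n) _ (Bounded-Svec n)
             (Bounded-ε⊙ n (xⁿ n) (Bounded-rotⁿ n 1̂ (≤-refl , z≤n , z≤n , z≤n , z≤n))))

boundW boundM : ℕ → ℕ
boundW zero    = 0
boundW (suc L) = 16 + 5 * boundW L + 20 * boundM L
boundM zero    = 0
boundM (suc L) = boundW L + 5 * boundM L

record Decomposition (L : ℕ) (v : C₅ ℤ) : Set where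
  field
    E X Y     : C₅ ℤ
    split     : v ≡ E ⊕ W ∗ X ⊕ M ∗ Y
    E-bounded : Bounded 16 E
    X-bounded : Bounded (boundW L) X
    Y-bounded : Bounded (boundM L) Y

Svec-decomposition : ∀ L n → n < 16 ^ L → Decomposition L (Svec n)
Svec-decomposition zero zero _ = record
  { E = 0̂ ; X = 0̂ ; Y = 0̂ ; split = refl
  ; E-bounded = Bounded-0̂ 16 ; X-bounded = Bounded-0̂ 0 ; Y-bounded = Bounded-0̂ 0 }
Svec-decomposition zero (suc n) (s≤s ())
Svec-decomposition (suc L) n n<16^L+1 = record
  { E = E′ ; X = E ⊕ ℤ.+ 5 ⊙ X ⊕ ℤ.+ 20 ⊙ Y ; Y = X ⊕ ℤ.+ 5 ⊙ Y
  ; split = split′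
  ; E-bounded = Bounded-mono E′ (<⇒≤ (m%n<n n 16))
                  (Bounded-ε⊙ a _ (Bounded-rotⁿ a _ (Bounded-Svec (n % 16))))
  ; X-bounded = Bounded-⊕ (E ⊕ ℤ.+ 5 ⊙ X) _ (Bounded-⊕ E _ E-bounded (Bounded-⊙ (ℤ.+ 5) X X-bounded))
                  (Bounded-⊙ (ℤ.+ 20) Y Y-bounded)
  ; Y-bounded = Bounded-⊕ X _ X-bounded (Bounded-⊙ (ℤ.+ 5) Y Y-bounded) }
  where
  a = n / 16
  E′ = ε a ⊙ rotⁿ a (Svec (n % 16))
  open Decomposition (Svec-decomposition L a (m<n*o⇒m/o<n (subst (n <_) (*-comm 16 (16 ^ L)) n<16^L+1)))
  open ≡-Reasoning
  split′ : Svec n ≡ E′ ⊕ W ∗ (E ⊕ ℤ.+ 5 ⊙ X ⊕ ℤ.+ 20 ⊙ Y) ⊕ M ∗ (X ⊕ ℤ.+ 5 ⊙ Y)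
  split′ = begin
    Svec n                                ≡⟨ cong Svec (m≡m%n+[m/n]*n n 16) ⟩
    Svec (n % 16 + a * 16)                ≡⟨ Svec-digits a (n % 16) (m%n<n n 16) ⟩
    W ∗ Svec a ⊕ E′                       ≡⟨ cong (λ v → W ∗ v ⊕ E′) split ⟩
    W ∗ (E ⊕ W ∗ X ⊕ M ∗ Y) ⊕ E′          ≡⟨ W∗-split E X Y E′ ⟩
    E′ ⊕ W ∗ (E ⊕ ℤ.+ 5 ⊙ X ⊕ ℤ.+ 20 ⊙ Y) ⊕ M ∗ (X ⊕ ℤ.+ 5 ⊙ Y) ∎

∣S₅₀₄∣-≤-bounds : ∀ L n → n < 16 ^ L → ∣ S₅₀₄ n ∣ ≤ 16 + 12 * boundW L + 56 * boundM L
∣S₅₀₄∣-≤-bounds L n n<16^L = subst (λ z → ∣ z ∣ ≤ 16 + 12 * boundW L + 56 * boundM L)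
  (sym (trans (S₅₀₄≡c0-Svec n) (cong c0 split)))
  (proj₁ (Bounded-⊕ (E ⊕ W ∗ X) (M ∗ Y) (Bounded-⊕ E (W ∗ X) E-bounded (Bounded-∗ W X X-bounded))
                    (Bounded-∗ M Y Y-bounded)))
  where open Decomposition (Svec-decomposition L n n<16^L)

-- (a , b) stands for a + b√5.
infixl 7 _⊠_
_⊠_ : ℕ × ℕ → ℕ × ℕ → ℕ × ℕ
(a , b) ⊠ (c , d) = a * c + 5 * (b * d) , a * d + c * b

⊠-identityˡ : ∀ x → (1 , 0) ⊠ x ≡ x
⊠-identityˡ (a , b) = cong₂ _,_ (lemma₁ a b) (lemma₂ a b)
  where
  lemma₁ : ∀ a b → 1 * a + 5 * (0 * b) ≡ a
  lemma₁ = solve-∀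
  lemma₂ : ∀ a b → 1 * b + a * 0 ≡ b
  lemma₂ = solve-∀

⊠-assoc : ∀ x y z → (x ⊠ y) ⊠ z ≡ x ⊠ (y ⊠ z)
⊠-assoc (a , b) (c , d) (e , f) = cong₂ _,_ (lemma₁ a b c d e f) (lemma₂ a b c d e f)
  where
  lemma₁ : ∀ a b c d e f → (a * c + 5 * (b * d)) * e + 5 * ((a * d + c * b) * f)
                         ≡ a * (c * e + 5 * (d * f)) + 5 * (b * (c * f + e * d))
  lemma₁ = solve-∀
  lemma₂ : ∀ a b c d e f → (a * c + 5 * (b * d)) * f + e * (a * d + c * b)
                         ≡ a * (c * f + e * d) + (c * e + 5 * (d * f)) * b
  lemma₂ = solve-∀

λPow-suc : ∀ q → λPow (suc q) ≡ (5 , 2) ⊠ λPow q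
λPow-suc q = cong₂ _,_ (lemma₁ (proj₁ (λPow q)) (proj₂ (λPow q)))
                       (lemma₂ (proj₁ (λPow q)) (proj₂ (λPow q)))
  where
  lemma₁ : ∀ a b → 5 * a + 10 * b ≡ 5 * a + 5 * (2 * b)
  lemma₁ = solve-∀
  lemma₂ : ∀ a b → 2 * a + 5 * b ≡ 5 * b + a * 2
  lemma₂ = solve-∀

λPow-+ : ∀ m n → λPow (m + n) ≡ λPow m ⊠ λPow n
λPow-+ zero    n = sym (⊠-identityˡ (λPow n))
λPow-+ (suc m) n = begin
  λPow (suc (m + n))           ≡⟨ λPow-suc (m + n) ⟩
  (5 , 2) ⊠ λPow (m + n)       ≡⟨ cong ((5 , 2) ⊠_) (λPow-+ m n) ⟩
  (5 , 2) ⊠ (λPow m ⊠ λPow n)  ≡⟨ ⊠-assoc (5 , 2) (λPow m) (λPow n) ⟨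
  (5 , 2) ⊠ λPow m ⊠ λPow n    ≡⟨ cong (_⊠ λPow n) (λPow-suc m) ⟨
  λPow (suc m) ⊠ λPow n        ∎
  where open ≡-Reasoning

weight : ℕ × ℕ → ℕ
weight (a , b) = a + b

weight-⊠ : ∀ x y → weight x * weight y ≤ weight (x ⊠ y)
weight-⊠ (a , b) (c , d) = ≤-trans (m≤m+n _ (4 * (b * d))) (≤-reflexive (expand a b c d))
  where
  expand : ∀ a b c d → (a + b) * (c + d) + 4 * (b * d) ≡ a * c + 5 * (b * d) + (a * d + c * b)
  expand = solve-∀

weight-λPow-^ : ∀ L q → weight (λPow L) ^ q ≤ weight (λPow (q * L))
weight-λPow-^ L zero    = ≤-refl
weight-λPow-^ L (suc q) = begin
  weight (λPow L) * weight (λPow L) ^ q     ≤⟨ *-monoʳ-≤ (weight (λPow L)) (weight-λPow-^ L q) ⟩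
  weight (λPow L) * weight (λPow (q * L))   ≤⟨ weight-⊠ (λPow L) (λPow (q * L)) ⟩
  weight (λPow L ⊠ λPow (q * L))            ≡⟨ cong weight (λPow-+ L (q * L)) ⟨
  weight (λPow (L + q * L))                 ∎
  where open ≤-Reasoning

weight-λPow-suc : ∀ L → weight (λPow (suc L)) ≤ 15 * weight (λPow L)
weight-λPow-suc L = lemma (proj₁ (λPow L)) (proj₂ (λPow L))
  where
  lemma : ∀ a b → 5 * a + 10 * b + (2 * a + 5 * b) ≤ 15 * (a + b)
  lemma a b = ≤-trans (m≤m+n _ (8 * a)) (≤-reflexive (regroup a b))
    where
    regroup : ∀ a b → 5 * a + 10 * b + (2 * a + 5 * b) + 8 * a ≡ 15 * (a + b)
    regroup = solve-∀

^-distrib-* : ∀ m n q → (m * n) ^ q ≡ m ^ q * n ^ q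
^-distrib-* m n zero    = refl
^-distrib-* m n (suc q) = trans (cong (m * n *_) (^-distrib-* m n q)) (interchange m n (m ^ q) (n ^ q))
  where
  interchange : ∀ a b c d → a * b * (c * d) ≡ a * c * (b * d)
  interchange = solve-∀

m*m≤n*n⇒m≤n : ∀ {m n} → m * m ≤ n * n → m ≤ n
m*m≤n*n⇒m≤n {m} {n} m²≤n² with m ≤? n
... | yes m≤n = m≤n
... | no  m≰n = contradiction m²≤n² (<⇒≱ (*-mono-< (≰⇒> m≰n) (≰⇒> m≰n)))

infix 4 _·√_≤_
record _·√_≤_ (s k t : ℕ) : Set where
  constructor squared
  field k·s²≤t² : k * (s * s) ≤ t * t

·√-* : ∀ {k s s′ t t′} → s ·√ k ≤ t → s′ ·√ k ≤ t′ → k * (s * s′) ≤ t * t′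
·√-* {k} {s} {s′} {t} {t′} (squared h) (squared h′) =
  m*m≤n*n⇒m≤n (subst₂ _≤_ (squareˡ k s s′) (squareʳ t t′) (*-mono-≤ h h′))
  where
  squareˡ : ∀ k s s′ → k * (s * s) * (k * (s′ * s′)) ≡ k * (s * s′) * (k * (s * s′))
  squareˡ = solve-∀
  squareʳ : ∀ t t′ → t * t * (t′ * t′) ≡ t * t′ * (t * t′)
  squareʳ = solve-∀

·√-+ : ∀ {k s s′ t t′} → s ·√ k ≤ t → s′ ·√ k ≤ t′ → s + s′ ·√ k ≤ t + t′
·√-+ {k} {s} {s′} {t} {t′} s√k≤t@(squared h) s′√k≤t′@(squared h′) = squared (begin
  k * ((s + s′) * (s + s′))                              ≡⟨ expand k s s′ ⟩
  k * (s * s) + 2 * (k * (s * s′)) + k * (s′ * s′)       ≤⟨ +-mono-≤ (+-mono-≤ h (*-monoʳ-≤ 2 (·√-* s√k≤t s′√k≤t′))) h′ ⟩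
  t * t + 2 * (t * t′) + t′ * t′                         ≡⟨ expandʳ t t′ ⟨
  (t + t′) * (t + t′)                                    ∎)
  where
  open ≤-Reasoning
  expand : ∀ k s s′ → k * ((s + s′) * (s + s′)) ≡ k * (s * s) + 2 * (k * (s * s′)) + k * (s′ * s′)
  expand = solve-∀
  expandʳ : ∀ t t′ → (t + t′) * (t + t′) ≡ t * t + 2 * (t * t′) + t′ * t′
  expandʳ = solve-∀

·√-scale : ∀ a {k s t} → s ·√ k ≤ t → a * s ·√ k ≤ a * t
·√-scale a {k} {s} {t} (squared h) = squared (subst₂ _≤_ (regroupˡ k a s) (regroupʳ a t) (*-monoʳ-≤ (a * a) h))
  where
  regroupˡ : ∀ k a s → a * a * (k * (s * s)) ≡ k * (a * s * (a * s))
  regroupˡ = solve-∀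
  regroupʳ : ∀ a t → a * a * (t * t) ≡ a * t * (a * t)
  regroupʳ = solve-∀

·√-mono : ∀ {k s t t′} → t ≤ t′ → s ·√ k ≤ t → s ·√ k ≤ t′
·√-mono t≤t′ (squared h) = squared (≤-trans h (*-mono-≤ t≤t′ t≤t′))

·√⇒≤ : ∀ {k s t} → s ·√ suc k ≤ t → s ≤ t
·√⇒≤ {k} {s} (squared h) = m*m≤n*n⇒m≤n (≤-trans (m≤n*m (s * s) (suc k)) h)

-- x ≼ c says x ≤ c in ℕ[√5].
infix 4 _≼_
_≼_ : ℕ × ℕ → ℕ → Set
(a , b) ≼ c = ∃[ u ] c ≡ a + u × b ·√ 5 ≤ u

≼-weight : ∀ x {c} → x ≼ c → weight x ≤ c
≼-weight (a , b) (u , refl , b√5≤u) = +-monoʳ-≤ a (·√⇒≤ b√5≤u)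

≼-⊠ : ∀ x y {c d} → x ≼ c → y ≼ d → x ⊠ y ≼ c * d
≼-⊠ (a , b) (a′ , b′) (u , refl , hu) (v , refl , hv) = a * v + u * a′ + w , product , dominated
  where
  bb′≤uv : 5 * (b * b′) ≤ u * v
  bb′≤uv = ·√-* hu hv
  w = u * v ∸ 5 * (b * b′)
  product : (a + u) * (a′ + v) ≡ a * a′ + 5 * (b * b′) + (a * v + u * a′ + w)
  product = begin
    (a + u) * (a′ + v)                                 ≡⟨ expand a u a′ v ⟩
    a * a′ + (a * v + u * a′) + u * v                  ≡⟨ cong (a * a′ + (a * v + u * a′) +_) (m+[n∸m]≡n bb′≤uv) ⟨
    a * a′ + (a * v + u * a′) + (5 * (b * b′) + w)     ≡⟨ regroup (a * a′) (a * v + u * a′) (5 * (b * b′)) w ⟩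
    a * a′ + 5 * (b * b′) + (a * v + u * a′ + w)       ∎
    where
    open ≡-Reasoning
    expand : ∀ a u a′ v → (a + u) * (a′ + v) ≡ a * a′ + (a * v + u * a′) + u * v
    expand = solve-∀
    regroup : ∀ x y z w → x + y + (z + w) ≡ x + z + (y + w)
    regroup = solve-∀
  dominated : a * b′ + a′ * b ·√ 5 ≤ a * v + u * a′ + w
  dominated = ·√-mono (m≤m+n _ w)
    (·√-+ (·√-scale a hv) (subst (λ t → a′ * b ·√ 5 ≤ t) (*-comm a′ u) (·√-scale a′ hu)))

λPow-*-≼ : ∀ {q c} L → λPow q ≼ c → λPow (L * q) ≼ c ^ L
λPow-*-≼ zero        _    = 0 , refl , squared z≤n
λPow-*-≼ {q} (suc L) λ^q≼c = subst (_≼ _) (sym (λPow-+ q (L * q)))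
  (≼-⊠ (λPow q) (λPow (L * q)) λ^q≼c (λPow-*-≼ L λ^q≼c))

ExpAbove⇒≼ : ∀ p q → ExpAbove p q → λPow q ≼ 16 ^ p
ExpAbove⇒≼ p q (A<16^p , 5B²<[16^p-A]²) =
  16 ^ p ∸ proj₁ (λPow q) , sym (m+[n∸m]≡n (<⇒≤ A<16^p)) , squared (<⇒≤ 5B²<[16^p-A]²)

weight-λPow-^-≤ : ∀ p q L → ExpAbove p q → weight (λPow L) ^ q ≤ (16 ^ L) ^ p
weight-λPow-^-≤ p q L above = begin
  weight (λPow L) ^ q        ≤⟨ weight-λPow-^ L q ⟩
  weight (λPow (q * L))      ≡⟨ cong (weight ∘ λPow) (*-comm q L) ⟩
  weight (λPow (L * q))      ≤⟨ ≼-weight (λPow (L * q)) (λPow-*-≼ L (ExpAbove⇒≼ p q above)) ⟩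
  (16 ^ p) ^ L               ≡⟨ ^-*-assoc 16 p L ⟩
  16 ^ (p * L)               ≡⟨ cong (16 ^_) (*-comm p L) ⟩
  16 ^ (L * p)               ≡⟨ ^-*-assoc 16 L p ⟨
  (16 ^ L) ^ p               ∎
  where open ≤-Reasoning

bounds≤λPow : ∀ L → boundW L + 16 ≤ 32 * proj₁ (λPow L) × boundM L ≤ 16 * proj₂ (λPow L)
bounds≤λPow zero    = m≤m+n 16 16 , z≤n
bounds≤λPow (suc L) = W-step , M-step
  where
  x = boundW L
  y = boundM L
  A = proj₁ (λPow L)
  B = proj₂ (λPow L)
  x+16≤32A = proj₁ (bounds≤λPow L)
  y≤16B = proj₂ (bounds≤λPow L)
  open ≤-Reasoning
  W-step : 16 + 5 * x + 20 * y + 16 ≤ 32 * (5 * A + 10 * B)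
  W-step = begin
    16 + 5 * x + 20 * y + 16          ≤⟨ m≤m+n _ 48 ⟩
    16 + 5 * x + 20 * y + 16 + 48     ≡⟨ regroup x y ⟩
    5 * (x + 16) + 20 * y             ≤⟨ +-mono-≤ (*-monoʳ-≤ 5 x+16≤32A) (*-monoʳ-≤ 20 y≤16B) ⟩
    5 * (32 * A) + 20 * (16 * B)      ≡⟨ collect A B ⟩
    32 * (5 * A + 10 * B)             ∎
    where
    regroup : ∀ x y → 16 + 5 * x + 20 * y + 16 + 48 ≡ 5 * (x + 16) + 20 * y
    regroup = solve-∀
    collect : ∀ A B → 5 * (32 * A) + 20 * (16 * B) ≡ 32 * (5 * A + 10 * B)
    collect = solve-∀
  M-step : x + 5 * y ≤ 16 * (2 * A + 5 * B)
  M-step = begin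
    x + 5 * y                         ≤⟨ +-monoˡ-≤ (5 * y) (m≤m+n x 16) ⟩
    x + 16 + 5 * y                    ≤⟨ +-mono-≤ x+16≤32A (*-monoʳ-≤ 5 y≤16B) ⟩
    32 * A + 5 * (16 * B)             ≡⟨ collect A B ⟩
    16 * (2 * A + 5 * B)              ∎
    where
    collect : ∀ A B → 32 * A + 5 * (16 * B) ≡ 16 * (2 * A + 5 * B)
    collect = solve-∀

∣S₅₀₄∣-≤-weight : ∀ L n → n < 16 ^ L → ∣ S₅₀₄ n ∣ ≤ 896 * weight (λPow L)
∣S₅₀₄∣-≤-weight L n n<16^L = begin
  ∣ S₅₀₄ n ∣                                ≤⟨ ∣S₅₀₄∣-≤-bounds L n n<16^L ⟩
  16 + 12 * x + 56 * y                      ≤⟨ m≤m+n _ 176 ⟩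
  16 + 12 * x + 56 * y + 176                ≡⟨ regroup x y ⟩
  12 * (x + 16) + 56 * y                    ≤⟨ +-mono-≤ (*-monoʳ-≤ 12 (proj₁ (bounds≤λPow L)))
                                                        (*-monoʳ-≤ 56 (proj₂ (bounds≤λPow L))) ⟩
  12 * (32 * A) + 56 * (16 * B)             ≤⟨ m≤m+n _ (512 * A) ⟩
  12 * (32 * A) + 56 * (16 * B) + 512 * A   ≡⟨ collect A B ⟩
  896 * (A + B)                             ∎
  where
  open ≤-Reasoning
  x = boundW L
  y = boundM L
  A = proj₁ (λPow L)
  B = proj₂ (λPow L)
  regroup : ∀ x y → 16 + 12 * x + 56 * y + 176 ≡ 12 * (x + 16) + 56 * y
  regroup = solve-∀
  collect : ∀ A B → 12 * (32 * A) + 56 * (16 * B) + 512 * A ≡ 896 * (A + B)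
  collect = solve-∀

log-bracket : ∀ b n → 1 < b → 1 ≤ n → ∃[ L ] b ^ L ≤ n × n < b ^ suc L
log-bracket b (suc zero) 1<b _ = 0 , ≤-refl , subst (1 <_) (sym (*-identityʳ b)) 1<b
log-bracket b (suc (suc n)) 1<b _ with log-bracket b (suc n) 1<b (s≤s z≤n)
... | L , b^L≤n+1 , n+1<b^L+1 with suc (suc n) <? b ^ suc L
...   | yes n+2<b^L+1 = L , ≤-trans b^L≤n+1 (n≤1+n (suc n)) , n+2<b^L+1
...   | no  n+2≮b^L+1 = suc L , ≮⇒≥ n+2≮b^L+1 , ≤-<-trans n+1<b^L+1 (^-monoʳ-< b 1<b (n<1+n (suc L)))

mainTheorem8 : ∃[ C ] ∃[ N ] ∀ (n : ℕ) → N ≤ n → ∀ (p q : ℕ) → 0 < q → ExpAbove p q →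
    ∣ S₅₀₄ n ∣ ^ q ≤ C ^ q * n ^ p
mainTheorem8 = 13440 , 1 , bound
  where
  bound : ∀ n → 1 ≤ n → ∀ p q → 0 < q → ExpAbove p q → ∣ S₅₀₄ n ∣ ^ q ≤ 13440 ^ q * n ^ p
  bound n 1≤n p q _ above with log-bracket 16 n (s≤s (s≤s z≤n)) 1≤n
  ... | L , 16^L≤n , n<16^L+1 = begin
    ∣ S₅₀₄ n ∣ ^ q                       ≤⟨ ^-monoˡ-≤ q (∣S₅₀₄∣-≤-weight (suc L) n n<16^L+1) ⟩
    (896 * weight (λPow (suc L))) ^ q    ≤⟨ ^-monoˡ-≤ q (*-monoʳ-≤ 896 (weight-λPow-suc L)) ⟩
    (896 * (15 * w)) ^ q                 ≡⟨ cong (_^ q) (*-assoc 896 15 w) ⟨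
    (13440 * w) ^ q                      ≡⟨ ^-distrib-* 13440 w q ⟩
    13440 ^ q * w ^ q                    ≤⟨ *-monoʳ-≤ (13440 ^ q) (weight-λPow-^-≤ p q L above) ⟩
    13440 ^ q * (16 ^ L) ^ p             ≤⟨ *-monoʳ-≤ (13440 ^ q) (^-monoˡ-≤ p 16^L≤n) ⟩
    13440 ^ q * n ^ p                    ∎
    where
    open ≤-Reasoning
    w = weight (λPow L)
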